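{- Let $f$ be a nested canalyzing function (NCF) of $n\ge 2$ variables, and suppose a default-normalized representation of $f$ contains $r_1$ layers in which all lines have the same canalyzing value and $r_2$ layers in which both canalyzing values $0$ and $1$ occur. Then $f$ is properly $(r_1+2r_2)$-symmetric.
   Context: A Boolean function $f(x_1,\dots,x_n)$ is nested canalyzing (an NCF) if there are a permutation $\pi$ of $\{1,\dots,n\}$, canalyzing values $a_1,\dots,a_n\in\{0,1\}$ and canalyzed values $b_1,\dots,b_n\in\{0,1\}$ such that $f$ is computed by the ordered list of rules "$x_{\pi(i)}: a_i\to b_i$" for $i=1,\dots,n$ followed by "Default: $\overline{b_n}$": i.e., $f(x)=b_i$ for the first $i$ with $x_{\pi(i)}=a_i$, and $f(x)=\overline{b_n}$ if $x_{\pi(i)}\neq a_i$ for all $i$. Such a list of $n$ lines is a representation of $f$. A layer of a representation is a maximal sequence of consecutive lines having the same canalyzed value. For $n\ge2$, a representation is default-normalized if lines $n-1$ and $n$ have the same canalyzed value. Two variables are symmetric if interchanging their values never changes the value of the function; $f$ is $r$-symmetric if its variables can be partitioned into at most $r$ groups such that any two variables in the same group are symmetric; $f$ is properly $r$-symmetric if it is $r$-symmetric but not $(r-1)$-symmetric. -}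

module Defs where

open import Data.Nat using (ℕ; zero; suc; _+_)
open import Data.Bool using (Bool; true; false; not; if_then_else_)
open import Data.Fin using (Fin; fromℕ; inject₁; _≟_)
open import Data.Fin.Permutation using (Permutation′; _⟨$⟩ʳ_)
open import Data.List using (List; []; _∷_; tabulate)
open import Data.Product using (_×_; _,_; Σ; ∃)
open import Relation.Binary.PropositionalEquality using (_≡_)
open import Relation.Nullary using (¬_; does)

BoolFun : ℕ → Set
BoolFun n = (Fin n → Bool) → Bool

-- A representation with n lines: line i reads "x_{π(i)} : a_i → b_i".
record Rep (n : ℕ) : Set where
  field
    perm : Permutation′ n
    can  : Fin n → Bool
    cvd  : Fin n → Bool

open Rep public

Line : ℕ → Set
Line n = Fin n × Bool × Bool

lines : ∀ {n} → Rep n → List (Line n)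
lines R = tabulate (λ i → (perm R ⟨$⟩ʳ i , can R i , cvd R i))

evalLines : ∀ {n} → Bool → List (Line n) → (Fin n → Bool) → Bool
evalLines d [] x = d
evalLines d ((v , a , b) ∷ ls) x =
  if does (Data.Bool._≟_ (x v) a) then b else evalLines d ls x

eval : ∀ {k} → Rep (suc k) → BoolFun (suc k)
eval {k} R = evalLines (not (cvd R (fromℕ k))) (lines R)

-- Default-normalized (n = m + 2 lines): lines n-1 and n have equal canalyzed value.
DefaultNormalized : ∀ {m} → Rep (suc (suc m)) → Set
DefaultNormalized {m} R = cvd R (inject₁ (fromℕ m)) ≡ cvd R (fromℕ (suc m))

-- Layers: maximal runs of consecutive lines with the same canalyzed value.
-- Each layer is recorded as the list of canalyzing values of its lines.
layersAux : Bool → List Bool → List (Bool × Bool) → List (List Bool)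
layersAux b acc [] = acc ∷ []
layersAux b acc ((a , b') ∷ ls) =
  if does (Data.Bool._≟_ b b') then layersAux b (a ∷ acc) ls
  else acc ∷ layersAux b' (a ∷ []) ls

layersOf : List (Bool × Bool) → List (List Bool)
layersOf [] = []
layersOf ((a , b) ∷ ls) = layersAux b (a ∷ []) ls

layers : ∀ {n} → Rep n → List (List Bool)
layers R = layersOf (tabulate (λ i → (can R i , cvd R i)))

hasVal : Bool → List Bool → Bool
hasVal v [] = false
hasVal v (a ∷ as) = if does (Data.Bool._≟_ a v) then true else hasVal v as

mixed : List Bool → Bool
mixed l = if hasVal true l then hasVal false l else false

countUniform : List (List Bool) → ℕ
countUniform [] = 0
countUniform (l ∷ ls) = if mixed l then countUniform ls else suc (countUniform ls)

countMixed : List (List Bool) → ℕ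
countMixed [] = 0
countMixed (l ∷ ls) = if mixed l then suc (countMixed ls) else countMixed ls

swapIn : ∀ {n} → Fin n → Fin n → (Fin n → Bool) → (Fin n → Bool)
swapIn i j x k =
  if does (k ≟ i) then x j else if does (k ≟ j) then x i else x k

Symmetric : ∀ {n} → BoolFun n → Fin n → Fin n → Set
Symmetric f i j = ∀ x → f (swapIn i j x) ≡ f x

-- r-symmetric: variables partitioned into at most r groups (labels in Fin r,
-- groups may be empty), any two variables in the same group symmetric.
RSymmetric : ∀ {n} → BoolFun n → ℕ → Set
RSymmetric {n} f r =
  Σ (Fin n → Fin r) λ g → ∀ i j → g i ≡ g j → Symmetric f i j

ProperlyRSymmetric : ∀ {n} → BoolFun n → ℕ → Set
ProperlyRSymmetric f zero = RSymmetric f zero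
ProperlyRSymmetric f (suc r) = RSymmetric f (suc r) × ¬ RSymmetric f r

module Submission where

-- Reorder the variables of f along the representation: line i reads the
-- variable x_{π(i)}, so f x = run d a b (x ∘ π) for the tables a (canalyzing
-- values), b (canalyzed values) and default d = ¬ b_n.  Scanning the lines
-- from first to last we give every line a label (a natural number): each layer
-- receives one fresh label if all its lines share a canalyzing value and two
-- fresh labels otherwise, and a line gets the first label of its layer, plus
-- one when its canalyzing value differs from that of the first line of the
-- layer.  The labels used are exactly 0, 1, …, T - 1 with T = r₁ + 2 r₂.
--
-- The heart of the proof is that lines i and j are symmetric (as variables of
-- run) iff they carry the same label: equal labels means same layer and same
-- canalyzing value, and such lines can be swapped; in every other case an
-- explicit input tells them apart, where default-normalization excludes a
-- final one-line layer.  Transporting this along π, the theorem follows from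
-- a general fact: a labelling of the variables by 0, …, T - 1 that is onto and
-- whose fibres are exactly the symmetry classes makes f properly T-symmetric
-- (one direction by the labelling itself, the other by pigeonhole).

open import Defs
open import Data.Nat using (ℕ; zero; suc; _+_; _*_; _≤_; _<_; z≤n; s≤s)
open import Data.Nat.Properties
  using ( ≤-refl; ≤-trans; <-≤-trans; <⇒≢; <⇒≱; ≤∧≢⇒<; n<1+n; m≤m+n; +-monoʳ-≤; +-monoʳ-<
        ; +-comm; +-assoc; +-identityʳ; +-cancelˡ-≡)
  renaming (_≟_ to _≟ℕ_)
open import Data.Nat.Tactic.RingSolver using (solve-∀)
open import Data.Bool using (Bool; true; false; not; if_then_else_; _∨_; _xor_)
open import Data.Bool.Properties using (¬-not; not-¬; xor-same; ∨-identityʳ; ∨-zeroʳ)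
import Data.Bool.Properties as Bool
open import Data.Fin using (Fin; toℕ; fromℕ; fromℕ<; _≟_) renaming (zero to fzero; suc to fsuc)
import Data.Fin as F
open import Data.Fin.Properties using (toℕ<n; toℕ-fromℕ<; suc-injective; <-cmp; pigeonhole)
open import Data.Fin.Permutation using (Permutation′; _⟨$⟩ʳ_; _⟨$⟩ˡ_; inverseˡ; inverseʳ)
open import Data.Vec.Functional using (head; tail; last) renaming (_∷_ to _◃_)
open import Data.List using (List; []; _∷_; tabulate)
open import Data.Product using (_×_; _,_; ∃; ∃₂; proj₁; proj₂)
open import Data.Unit using (⊤)
open import Data.Empty using (⊥; ⊥-elim)
open import Function using (_∘_)
open import Function.Bundles using (_⇔_; mk⇔; Equivalence)
open import Relation.Binary.PropositionalEquality
open import Relation.Binary.Definitions using (tri<; tri≈; tri>)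
open import Relation.Nullary using (¬_; does; yes; no)
open import Relation.Nullary.Decidable using (dec-true; dec-false)

variable
  n : ℕ
  d β c : Bool

run : Bool → (a b : Fin n → Bool) → (Fin n → Bool) → Bool
run {zero}  d a b y = d
run {suc n} d a b y =
  if does (head y Bool.≟ head a) then head b else run d (tail a) (tail b) (tail y)

run-hit : (a b y : Fin (suc n) → Bool) → head y ≡ head a → run d a b y ≡ head b
run-hit {d = d} a b y hit =
  cong (λ t → if t then head b else run d (tail a) (tail b) (tail y)) (dec-true (head y Bool.≟ head a) hit)

run-skip : (a b : Fin (suc n) → Bool) (z : Fin n → Bool) →
  run d a b (not (head a) ◃ z) ≡ run d (tail a) (tail b) z
run-skip {d = d} a b z =
  cong (λ t → if t then head b else run d (tail a) (tail b) z)
       (dec-false (not (head a) Bool.≟ head a) (λ e → not-¬ refl (sym e)))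

evalLines-run : {N : ℕ} (d : Bool) (p : Fin n → Fin N) (a b : Fin n → Bool) (x : Fin N → Bool) →
  evalLines d (tabulate (λ i → p i , a i , b i)) x ≡ run d a b (λ i → x (p i))
evalLines-run {zero}  d p a b x = refl
evalLines-run {suc n} d p a b x =
  cong (λ r → if does (x (p fzero) Bool.≟ head a) then head b else r)
       (evalLines-run d (p ∘ fsuc) (tail a) (tail b) x)

Extensional : BoolFun n → Set
Extensional f = ∀ {x y} → (∀ k → x k ≡ y k) → f x ≡ f y

run-ext : (a b : Fin n → Bool) → Extensional (run d a b)
run-ext {zero}  a b x≗y = refl
run-ext {suc n} a b x≗y =
  cong₂ (λ u r → if does (u Bool.≟ head a) then head b else r)
        (x≗y fzero) (run-ext (tail a) (tail b) (x≗y ∘ fsuc))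

swap-second : (i j : Fin n) (x : Fin n → Bool) → swapIn i j x j ≡ x i
swap-second i j x with j ≟ i
... | yes refl = refl
... | no _ rewrite dec-true (j ≟ j) refl = refl

swap-comm : (i j : Fin n) (x : Fin n → Bool) (k : Fin n) → swapIn i j x k ≡ swapIn j i x k
swap-comm i j x k with k ≟ i | k ≟ j
... | yes refl | yes refl = refl
... | yes refl | no _ = refl
... | no _ | yes refl = refl
... | no _ | no _ = refl

swap-refl : (i : Fin n) (x : Fin n → Bool) (k : Fin n) → swapIn i i x k ≡ x k
swap-refl i x k with k ≟ i
... | yes refl = refl
... | no _ = refl

swap-cong : (i j : Fin n) {x x′ : Fin n → Bool} → (∀ k → x k ≡ x′ k) → ∀ k → swapIn i j x k ≡ swapIn i j x′ k
swap-cong i j x≗x′ k with k ≟ i | k ≟ j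
... | yes _ | _ = x≗x′ j
... | no _ | yes _ = x≗x′ i
... | no _ | no _ = x≗x′ k

symmetric-refl : {f : BoolFun n} → Extensional f → (i : Fin n) → Symmetric f i i
symmetric-refl ext i x = ext (swap-refl i x)

symmetric-flip : {f : BoolFun n} → Extensional f → {i j : Fin n} → Symmetric f i j → Symmetric f j i
symmetric-flip ext {i} {j} S x = trans (ext (swap-comm j i x)) (S x)

-- Reading the variables through a permutation π: x_{π(k)} equals x_v exactly
-- when k = π⁻¹(v), so swapping v, w before reordering is swapping π⁻¹ v, π⁻¹ w after.
does-perm : (π : Permutation′ n) (k v : Fin n) → does (π ⟨$⟩ʳ k ≟ v) ≡ does (k ≟ π ⟨$⟩ˡ v)
does-perm π k v with k ≟ π ⟨$⟩ˡ v
... | yes refl = dec-true (_ ≟ v) (inverseʳ π)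
... | no k≢ = dec-false (_ ≟ v) (λ e → k≢ (trans (sym (inverseˡ π)) (cong (π ⟨$⟩ˡ_) e)))

permute-swap : (π : Permutation′ n) (v w : Fin n) (x : Fin n → Bool) (k : Fin n) →
  swapIn v w x (π ⟨$⟩ʳ k) ≡ swapIn (π ⟨$⟩ˡ v) (π ⟨$⟩ˡ w) (λ u → x (π ⟨$⟩ʳ u)) k
permute-swap π v w x k
  rewrite does-perm π k v | does-perm π k w | inverseʳ π {v} | inverseʳ π {w} = refl

symmetric-permute : (π : Permutation′ n) {f g : BoolFun n} → Extensional g →
  (∀ x → f x ≡ g (λ k → x (π ⟨$⟩ʳ k))) →
  (v w : Fin n) → Symmetric g (π ⟨$⟩ˡ v) (π ⟨$⟩ˡ w) ⇔ Symmetric f v w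
symmetric-permute π {f} {g} ext f≡g v w = mk⇔ to from
  where
  open ≡-Reasoning
  v′ w′ : Fin _
  v′ = π ⟨$⟩ˡ v
  w′ = π ⟨$⟩ˡ w

  to : Symmetric g v′ w′ → Symmetric f v w
  to S x = begin
    f (swapIn v w x)                          ≡⟨ f≡g _ ⟩
    g (λ k → swapIn v w x (π ⟨$⟩ʳ k))         ≡⟨ ext (permute-swap π v w x) ⟩
    g (swapIn v′ w′ (λ k → x (π ⟨$⟩ʳ k)))      ≡⟨ S _ ⟩
    g (λ k → x (π ⟨$⟩ʳ k))                    ≡⟨ sym (f≡g x) ⟩
    f x                                       ∎

  from : Symmetric f v w → Symmetric g v′ w′
  from S y = begin
    g (swapIn v′ w′ y)                        ≡⟨ ext (swap-cong v′ w′ (sym ∘ back)) ⟩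
    g (swapIn v′ w′ (λ k → x (π ⟨$⟩ʳ k)))      ≡⟨ ext (sym ∘ permute-swap π v w x) ⟩
    g (λ k → swapIn v w x (π ⟨$⟩ʳ k))         ≡⟨ sym (f≡g _) ⟩
    f (swapIn v w x)                          ≡⟨ S x ⟩
    f x                                       ≡⟨ f≡g x ⟩
    g (λ k → x (π ⟨$⟩ʳ k))                    ≡⟨ ext back ⟩
    g y                                       ∎
    where
    x : Fin _ → Bool
    x u = y (π ⟨$⟩ˡ u)
    back : ∀ k → x (π ⟨$⟩ʳ k) ≡ y k
    back k = cong y (inverseˡ π)

grouping-by-label : (f : BoolFun n) (T : ℕ) (ℓ : Fin n → ℕ) → (∀ i → ℓ i < T) →
  (∀ i j → ℓ i ≡ ℓ j → Symmetric f i j) → RSymmetric f T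
grouping-by-label f T ℓ bound sym-of =
  (λ i → fromℕ< (bound i)) ,
  λ i j e → sym-of i j (trans (sym (toℕ-fromℕ< (bound i))) (trans (cong toℕ e) (toℕ-fromℕ< (bound j))))

-- Fewer groups are impossible: among T variables with distinct labels, two
-- would share a group (pigeonhole) yet they are not symmetric.
no-fewer-groups : (f : BoolFun n) (r : ℕ) (ℓ : Fin n → ℕ) →
  (∀ t → t < suc r → ∃ λ i → ℓ i ≡ t) →
  (∀ i j → ℓ i ≢ ℓ j → ¬ Symmetric f i j) → ¬ RSymmetric f r
no-fewer-groups f r ℓ onto asym-of (g , g-sym) = collide (pigeonhole (n<1+n r) (g ∘ rep))
  where
  rep : Fin (suc r) → Fin _
  rep c = proj₁ (onto (toℕ c) (toℕ<n c))
  labelled : ∀ c → ℓ (rep c) ≡ toℕ c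
  labelled c = proj₂ (onto (toℕ c) (toℕ<n c))
  collide : (∃₂ λ c₁ c₂ → c₁ F.< c₂ × g (rep c₁) ≡ g (rep c₂)) → ⊥
  collide (c₁ , c₂ , c₁<c₂ , same-group) =
    asym-of (rep c₁) (rep c₂) (λ e → <⇒≢ c₁<c₂ (trans (sym (labelled c₁)) (trans e (labelled c₂))))
            (g-sym (rep c₁) (rep c₂) same-group)

properly-symmetric : (f : BoolFun n) (T : ℕ) (ℓ : Fin n → ℕ) →
  (∀ i → ℓ i < T) → (∀ t → t < T → ∃ λ i → ℓ i ≡ t) →
  (∀ i j → ℓ i ≡ ℓ j → Symmetric f i j) → (∀ i j → ℓ i ≢ ℓ j → ¬ Symmetric f i j) →
  ProperlyRSymmetric f T
properly-symmetric f zero ℓ bound onto sym-of asym-of = grouping-by-label f zero ℓ bound sym-of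
properly-symmetric f (suc r) ℓ bound onto sym-of asym-of =
  grouping-by-label f (suc r) ℓ bound sym-of , no-fewer-groups f r ℓ onto asym-of

AllUpTo : Bool → (Fin n → Bool) → Fin n → Set
AllUpTo β b fzero    = head b ≡ β
AllUpTo β b (fsuc k) = head b ≡ β × AllUpTo β (tail b) k

AllBefore : Bool → (Fin n → Bool) → Fin n → Set
AllBefore β b fzero    = ⊤
AllBefore β b (fsuc k) = head b ≡ β × AllBefore β (tail b) k

allUpTo-at : (b : Fin n → Bool) (k : Fin n) → AllUpTo β b k → b k ≡ β
allUpTo-at b fzero    eq       = eq
allUpTo-at b (fsuc k) (_ , up) = allUpTo-at (tail b) k up

-- If lines 0, …, k all output β and line k fires, the result is β,
-- whichever of these lines fires first.
fire : (a b : Fin n → Bool) (k : Fin n) {y : Fin n → Bool} →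
  AllUpTo β b k → y k ≡ a k → run d a b y ≡ β
fire a b fzero   {y} first        yk = trans (run-hit a b y yk) first
fire a b (fsuc k) {y} (first , up) yk with head y Bool.≟ head a
... | yes _ = first
... | no  _ = fire (tail a) (tail b) k up yk

reach : (a b : Fin (suc n) → Bool) → d ≡ not (last b) → ∀ v → ∃ λ y → run d a b y ≡ v
reach {zero} a b default v with v Bool.≟ head b
... | yes refl = (λ _ → head a) , run-hit a b (λ _ → head a) refl
... | no  v≢b  = (not (head a) ◃ λ ()) , trans (run-skip a b (λ ())) (trans default (sym (¬-not v≢b)))
reach {suc n} a b default v with y , y↦v ← reach (tail a) (tail b) default v =
  (not (head a) ◃ y) , trans (run-skip a b y) y↦v

hit-line : (a b : Fin n → Bool) (t j : Fin n) (v : Bool) → t F.≤ j → (t ≡ j → a t ≡ v) →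
  ∃ λ y → y j ≡ v × run d a b y ≡ b t
hit-line a b fzero fzero v _ same = (λ _ → v) , refl , run-hit a b (λ _ → v) (sym (same refl))
hit-line a b fzero (fsuc j) v _ _ = (head a ◃ λ _ → v) , refl , run-hit a b (head a ◃ λ _ → v) refl
hit-line a b (fsuc t) (fsuc j) v (s≤s t≤j) same
  with y , yj , y↦bt ← hit-line (tail a) (tail b) t j v t≤j (same ∘ cong fsuc) =
  (not (head a) ◃ y) , yj , trans (run-skip a b y) y↦bt

miss-through : (a b : Fin (suc n) → Bool) → d ≡ not (last b) → (k : Fin (suc n)) (v : Bool) →
  (k ≡ fromℕ n → v ≡ d) → ∃ λ y → y k ≡ not (a k) × run d a b y ≡ v
miss-through {zero} a b default fzero v at-last =
  (not (head a) ◃ λ ()) , refl , trans (run-skip a b (λ ())) (sym (at-last refl))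
miss-through {suc n} a b default fzero v _
  with y , y↦v ← reach (tail a) (tail b) default v =
  (not (head a) ◃ y) , refl , trans (run-skip a b y) y↦v
miss-through {suc n} a b default (fsuc k) v at-last
  with y , yk , y↦v ← miss-through (tail a) (tail b) default k v (at-last ∘ cong fsuc) =
  (not (head a) ◃ y) , yk , trans (run-skip a b y) y↦v

symmetric-tail : (a b : Fin (suc n) → Bool) {i j : Fin n} →
  Symmetric (run d (tail a) (tail b)) i j → Symmetric (run d a b) (fsuc i) (fsuc j)
symmetric-tail {d = d} a b S y =
  cong (λ r → if does (head y Bool.≟ head a) then head b else r) (S (tail y))

symmetric-untail : (a b : Fin (suc n) → Bool) {i j : Fin n} →
  Symmetric (run d a b) (fsuc i) (fsuc j) → Symmetric (run d (tail a) (tail b)) i j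
symmetric-untail a b {i} {j} S y =
  trans (sym (run-skip a b (swapIn i j y))) (trans (S (not (head a) ◃ y)) (run-skip a b y))

symmetric-head : (a b : Fin (suc n) → Bool) (j : Fin n) →
  AllUpTo (head b) (tail b) j → a (fsuc j) ≡ head a → Symmetric (run d a b) fzero (fsuc j)
symmetric-head a b j layer same y
  with head y Bool.≟ head a | y (fsuc j) Bool.≟ head a
... | yes _   | yes _  = refl
... | yes hit | no _   =
  fire (tail a) (tail b) j layer (trans (swap-second fzero (fsuc j) y) (trans hit (sym same)))
... | no _    | yes hit′ = sym (fire (tail a) (tail b) j layer (trans hit′ (sym same)))
... | no miss | no miss′ = run-ext (tail a) (tail b) agree
  where
  agree : ∀ k → (swapIn fzero (fsuc j) y) (fsuc k) ≡ y (fsuc k)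
  agree k with k ≟ j
  ... | yes refl = trans (¬-not miss) (sym (¬-not miss′))
  ... | no _ = refl

-- Line 0 and line j + 1 are not symmetric as soon as some input z of the
-- remaining lines shows the canalyzing value a₀ at line j + 1 and still yields ¬ b₀:
-- then ¬ a₀ ◃ z yields ¬ b₀, while after the swap line 0 fires and yields b₀.
asymmetric-head : (a b : Fin (suc n) → Bool) (j : Fin n) (z : Fin n → Bool) →
  z j ≡ head a → run d (tail a) (tail b) z ≡ not (head b) → ¬ Symmetric (run d a b) fzero (fsuc j)
asymmetric-head {d = d} a b j z zj z↦¬b S = not-¬ refl (begin
  head b                                ≡⟨ sym (run-hit a b (swapIn fzero (fsuc j) y) zj) ⟩
  run d a b (swapIn fzero (fsuc j) y)   ≡⟨ S y ⟩
  run d a b y                           ≡⟨ run-skip a b z ⟩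
  run d (tail a) (tail b) z             ≡⟨ z↦¬b ⟩
  not (head b)                          ∎)
  where
  open ≡-Reasoning
  y : Fin _ → Bool
  y = not (head a) ◃ z

not-other : {u v : Bool} → u ≢ v → not u ≡ v
not-other u≢v = sym (¬-not (u≢v ∘ sym))

layer-end : (b : Fin (suc n) → Bool) (j : Fin (suc n)) → d ≡ not (last b) →
  AllUpTo β b j → j ≡ fromℕ n → not β ≡ d
layer-end b j default layer refl = sym (trans default (cong not (allUpTo-at b j layer)))

-- The last two entries of c ◃ b coincide: the form default-normalization takes
-- on a suffix of the table, c being the canalyzed value of the preceding line.
LastTwo : Bool → (Fin (suc n) → Bool) → Set
LastTwo {zero}  c b = c ≡ head b
LastTwo {suc n} c b = LastTwo (head b) (tail b)

normalised-lastTwo : (m : ℕ) (c : Bool) (b : Fin (suc (suc m)) → Bool) →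
  b (F.inject₁ (fromℕ m)) ≡ b (fromℕ (suc m)) → LastTwo c b
normalised-lastTwo zero    c b twins = twins
normalised-lastTwo (suc m) c b twins = normalised-lastTwo m (head b) (tail b) twins

break-not-last : (b : Fin (suc n) → Bool) (t : Fin (suc n)) →
  LastTwo β b → AllBefore β b t → b t ≡ not β → t ≢ fromℕ n
break-not-last {zero}  b fzero    twins _ flip _ = not-¬ (sym twins) flip
break-not-last {suc n} b (fsuc t) twins (first , before) flip at-last =
  break-not-last (tail b) t (subst (λ c → LastTwo c (tail b)) first twins) before flip (suc-injective at-last)

-- The state records the
-- canalyzed value of the current layer, the canalyzing value of its first line,
-- whether both canalyzing values have occurred in it so far, and the number of
-- labels used by the earlier layers.

bit : Bool → ℕ
bit false = 0
bit true  = 1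

record Scan : Set where
  constructor scan
  field
    layerCvd   : Bool
    layerCan   : Bool
    layerMixed : Bool
    base       : ℕ
open Scan

-- The first label not used by the current layer (one or two labels for it).
next : Scan → ℕ
next s = base s + suc (bit (layerMixed s))

step : Scan → Bool → Bool → Scan
step s a b =
  if does (layerCvd s Bool.≟ b)
  then scan (layerCvd s) (layerCan s) (layerMixed s ∨ (a xor layerCan s)) (base s)
  else scan b a false (next s)

data StepCase (s : Scan) (a b : Bool) : Scan → Set where
  continue  : b ≡ layerCvd s →
              StepCase s a b (scan (layerCvd s) (layerCan s) (layerMixed s ∨ (a xor layerCan s)) (base s))
  new-layer : b ≡ not (layerCvd s) → StepCase s a b (scan b a false (next s))

step-case : (s : Scan) (a b : Bool) → StepCase s a b (step s a b)
step-case s a b with b Bool.≟ layerCvd s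
... | yes refl rewrite dec-true (layerCvd s Bool.≟ layerCvd s) refl = continue refl
... | no  b≢β rewrite dec-false (layerCvd s Bool.≟ b) (b≢β ∘ sym) = new-layer (¬-not b≢β)

group : Scan → Bool → Bool → ℕ
group s a b = base (step s a b) + bit (a xor layerCan (step s a b))

label : Scan → (a b : Fin n → Bool) → Fin n → ℕ
label s a b fzero    = group s (head a) (head b)
label s a b (fsuc k) = label (step s (head a) (head b)) (tail a) (tail b) k

total : Scan → (a b : Fin n → Bool) → ℕ
total {zero}  s a b = next s
total {suc n} s a b = total (step s (head a) (head b)) (tail a) (tail b)

layerCvd-step : (s : Scan) (a b : Bool) → layerCvd (step s a b) ≡ b
layerCvd-step s a b with step s a b | step-case s a b
... | _ | continue same  = sym same
... | _ | new-layer _    = refl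

bit-∨ˡ : ∀ u v → bit u ≤ bit (u ∨ v)
bit-∨ˡ true  v = ≤-refl
bit-∨ˡ false v = z≤n

bit-∨ʳ : ∀ u v → bit v ≤ bit (u ∨ v)
bit-∨ʳ true  true  = ≤-refl
bit-∨ʳ true  false = z≤n
bit-∨ʳ false v     = ≤-refl

bit-xor-injective : ∀ u v w → bit (u xor w) ≡ bit (v xor w) → u ≡ v
bit-xor-injective true  true  w     _  = refl
bit-xor-injective false false w     _  = refl
bit-xor-injective true  false true  ()
bit-xor-injective true  false false ()
bit-xor-injective false true  true  ()
bit-xor-injective false true  false ()

base-step : (s : Scan) (a b : Bool) → base s ≤ base (step s a b)
base-step s a b with step s a b | step-case s a b
... | _ | continue _  = ≤-refl
... | _ | new-layer _ = m≤m+n (base s) _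

next-step : (s : Scan) (a b : Bool) → next s ≤ next (step s a b)
next-step s a b with step s a b | step-case s a b
... | _ | continue _  = +-monoʳ-≤ (base s) (s≤s (bit-∨ˡ (layerMixed s) _))
... | _ | new-layer _ = m≤m+n (next s) _

group-below-next : (s : Scan) (a b : Bool) → group s a b < next (step s a b)
group-below-next s a b with step s a b | step-case s a b
... | _ | continue _  = +-monoʳ-< (base s) (s≤s (bit-∨ʳ (layerMixed s) _))
... | _ | new-layer _ rewrite xor-same a = +-monoʳ-< (next s) (s≤s z≤n)

one-more : ∀ c v → c ≤ v → v ≢ c → c + 1 ≤ v
one-more c v c≤v v≢c = subst (_≤ v) (+-comm 1 c) (≤∧≢⇒< c≤v (v≢c ∘ sym))

next-past-group : (s : Scan) (a b : Bool) (v : ℕ) → next s ≤ v → v ≢ group s a b → next (step s a b) ≤ v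
next-past-group s a b v next≤v v≢group with step s a b | step-case s a b
... | _ | new-layer _ rewrite xor-same a | +-identityʳ (next s) = one-more (next s) v next≤v v≢group
... | _ | continue _ with layerMixed s | a xor layerCan s
...   | true  | _     = next≤v
...   | false | false = next≤v
...   | false | true  = subst (_≤ v) (+-assoc (base s) 1 1) (one-more (base s + 1) v next≤v v≢group)

label-within : (s : Scan) (a b : Fin n → Bool) (k : Fin n) →
  AllUpTo (layerCvd s) b k → label s a b k ≡ base s + bit (a k xor layerCan s)
label-within s a b fzero first with step s (head a) (head b) | step-case s (head a) (head b)
... | _ | continue _     = refl
... | _ | new-layer flip = ⊥-elim (not-¬ first flip)
label-within s a b (fsuc k) (first , up) with step s (head a) (head b) | step-case s (head a) (head b)
... | _ | continue _     = label-within _ (tail a) (tail b) k up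
... | _ | new-layer flip = ⊥-elim (not-¬ first flip)

label-base : (s : Scan) (a b : Fin n → Bool) (k : Fin n) → base s ≤ label s a b k
label-base s a b fzero    = ≤-trans (base-step s (head a) (head b)) (m≤m+n _ _)
label-base s a b (fsuc k) =
  ≤-trans (base-step s (head a) (head b)) (label-base (step s (head a) (head b)) (tail a) (tail b) k)

label-after-break : (s : Scan) (a b : Fin n → Bool) (t k : Fin n) → t F.≤ k →
  AllBefore (layerCvd s) b t → b t ≡ not (layerCvd s) → next s ≤ label s a b k
label-after-break s a b fzero fzero _ _ flip with step s (head a) (head b) | step-case s (head a) (head b)
... | _ | continue same = ⊥-elim (not-¬ same flip)
... | _ | new-layer _   = m≤m+n (next s) _
label-after-break s a b fzero (fsuc k) _ _ flip with step s (head a) (head b) | step-case s (head a) (head b)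
... | _  | continue same = ⊥-elim (not-¬ same flip)
... | s′ | new-layer _   = label-base s′ (tail a) (tail b) k
label-after-break s a b (fsuc t) (fsuc k) (s≤s t≤k) (first , before) flip =
  ≤-trans (next-step s (head a) (head b)) (in-rest (step-case s (head a) (head b)))
  where
  -- line 0 continues the layer, so the break lies in the rest of the table
  in-rest : ∀ {s′} → StepCase s (head a) (head b) s′ → next s′ ≤ label s′ (tail a) (tail b) k
  in-rest (continue _)      = label-after-break _ (tail a) (tail b) t k t≤k before flip
  in-rest (new-layer flip′) = ⊥-elim (not-¬ first flip′)

total-above-next : (s : Scan) (a b : Fin n → Bool) → next s ≤ total s a b
total-above-next {zero}  s a b = ≤-refl
total-above-next {suc n} s a b =
  ≤-trans (next-step s (head a) (head b)) (total-above-next (step s (head a) (head b)) (tail a) (tail b))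

label-bound : (s : Scan) (a b : Fin n → Bool) (k : Fin n) → label s a b k < total s a b
label-bound s a b fzero =
  <-≤-trans (group-below-next s (head a) (head b)) (total-above-next _ (tail a) (tail b))
label-bound s a b (fsuc k) = label-bound (step s (head a) (head b)) (tail a) (tail b) k

label-onto : (s : Scan) (a b : Fin n → Bool) (v : ℕ) → next s ≤ v → v < total s a b →
  ∃ λ k → label s a b k ≡ v
label-onto {zero}  s a b v next≤v v<total = ⊥-elim (<⇒≱ v<total next≤v)
label-onto {suc n} s a b v next≤v v<total with v ≟ℕ group s (head a) (head b)
... | yes refl   = fzero , refl
... | no v≢group
  with k , k↦v ← label-onto (step s (head a) (head b)) (tail a) (tail b) v
                   (next-past-group s (head a) (head b) v next≤v v≢group) v<total
  = fsuc k , k↦v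

data LayerView (β : Bool) (b : Fin n → Bool) (j : Fin n) : Set where
  within   : AllUpTo β b j → LayerView β b j
  break-at : (t : Fin n) → t F.≤ j → AllBefore β b t → b t ≡ not β → LayerView β b j

layer-view : (β : Bool) (b : Fin n → Bool) (j : Fin n) → LayerView β b j
layer-view {suc n} β b j with head b Bool.≟ β
... | no  flip = break-at fzero z≤n _ (¬-not flip)
layer-view β b fzero    | yes first = within first
layer-view β b (fsuc j) | yes first with layer-view β (tail b) j
... | within up                   = within (first , up)
... | break-at t t≤j before flip′ = break-at (fsuc t) (s≤s t≤j) (first , before) flip′

head-label-within : (s : Scan) (a b : Fin (suc n) → Bool) (j : Fin n) → AllUpTo (head b) (tail b) j →
  label s a b fzero ≡ label s a b (fsuc j) ⇔ a (fsuc j) ≡ head a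
head-label-within s a b j layer = mk⇔
  (λ eq → sym (bit-xor-injective _ _ _ (+-cancelˡ-≡ (base s′) _ _ (trans eq later))))
  (λ same → trans (cong (λ u → base s′ + bit (u xor layerCan s′)) (sym same)) (sym later))
  where
  s′ : Scan
  s′ = step s (head a) (head b)
  later : label s′ (tail a) (tail b) j ≡ base s′ + bit (a (fsuc j) xor layerCan s′)
  later = label-within s′ (tail a) (tail b) j
            (subst (λ β → AllUpTo β (tail b) j) (sym (layerCvd-step s (head a) (head b))) layer)

head-label-break : (s : Scan) (a b : Fin (suc n) → Bool) (t j : Fin n) → t F.≤ j →
  AllBefore (head b) (tail b) t → tail b t ≡ not (head b) → label s a b fzero < label s a b (fsuc j)
head-label-break s a b t j t≤j before flip =
  <-≤-trans (group-below-next s (head a) (head b))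
            (label-after-break s′ (tail a) (tail b) t j t≤j
               (subst (λ β → AllBefore β (tail b) t) (sym layer-cvd) before)
               (subst (λ β → tail b t ≡ not β) (sym layer-cvd) flip))
  where
  s′ : Scan
  s′ = step s (head a) (head b)
  layer-cvd : layerCvd s′ ≡ head b
  layer-cvd = layerCvd-step s (head a) (head b)

head-symmetric : (s : Scan) (a b : Fin (suc n) → Bool) (j : Fin n) →
  label s a b fzero ≡ label s a b (fsuc j) → Symmetric (run d a b) fzero (fsuc j)
head-symmetric s a b j eq with layer-view (head b) (tail b) j
... | within layer =
  symmetric-head a b j layer (Equivalence.to (head-label-within s a b j layer) eq)
... | break-at t t≤j before flip = ⊥-elim (<⇒≢ (head-label-break s a b t j t≤j before flip) eq)

head-asymmetric : (s : Scan) (a b : Fin (suc n) → Bool) (j : Fin n) → LastTwo c b → d ≡ not (last b) →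
  label s a b fzero ≢ label s a b (fsuc j) → ¬ Symmetric (run d a b) fzero (fsuc j)
head-asymmetric {suc n} s a b j twins default neq with layer-view (head b) (tail b) j
... | within layer
  with z , zj , z↦¬b ← miss-through (tail a) (tail b) default j (not (head b))
                          (layer-end (tail b) j default layer)
  = asymmetric-head a b j z
      (trans zj (not-other (neq ∘ Equivalence.from (head-label-within s a b j layer)))) z↦¬b
... | break-at t t≤j before flip with t ≟ j
...   | no t≢j
  with z , zj , z↦bt ← hit-line (tail a) (tail b) t j (head a) t≤j (⊥-elim ∘ t≢j)
  = asymmetric-head a b j z zj (trans z↦bt flip)
...   | yes refl with tail a t Bool.≟ head a
...     | yes same
  with z , zt , z↦bt ← hit-line (tail a) (tail b) t t (head a) ≤-refl (λ _ → same)
  = asymmetric-head a b t z zt (trans z↦bt flip)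
...     | no differ
  with z , zt , z↦¬b ← miss-through (tail a) (tail b) default t (not (head b))
                          (⊥-elim ∘ break-not-last (tail b) t twins before flip)
  = asymmetric-head a b t z (trans zt (not-other differ)) z↦¬b

label-symmetric : (s : Scan) (a b : Fin n → Bool) {i j : Fin n} → i F.< j →
  label s a b i ≡ label s a b j → Symmetric (run d a b) i j
label-symmetric s a b {fzero}  {fsuc j} _          eq = head-symmetric s a b j eq
label-symmetric s a b {fsuc i} {fsuc j} (s≤s i<j) eq =
  symmetric-tail a b (label-symmetric (step s (head a) (head b)) (tail a) (tail b) i<j eq)

label-asymmetric : (s : Scan) (a b : Fin (suc n) → Bool) → LastTwo c b → d ≡ not (last b) →
  {i j : Fin (suc n)} → i F.< j → label s a b i ≢ label s a b j → ¬ Symmetric (run d a b) i j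
label-asymmetric s a b twins default {fzero} {fsuc j} _ neq = head-asymmetric s a b j twins default neq
label-asymmetric {suc n} s a b twins default {fsuc i} {fsuc j} (s≤s i<j) neq =
  label-asymmetric (step s (head a) (head b)) (tail a) (tail b) twins default i<j neq
  ∘ symmetric-untail a b {i} {j}

label-decides-symmetry : (s : Scan) (a b : Fin (suc n) → Bool) → LastTwo c b → d ≡ not (last b) →
  (i j : Fin (suc n)) →
  (label s a b i ≡ label s a b j → Symmetric (run d a b) i j) ×
  (label s a b i ≢ label s a b j → ¬ Symmetric (run d a b) i j)
label-decides-symmetry s a b twins default i j with <-cmp i j
... | tri< i<j _ _ = label-symmetric s a b i<j , label-asymmetric s a b twins default i<j
... | tri≈ _ refl _ = (λ _ → symmetric-refl (run-ext a b) i) , (λ neq → ⊥-elim (neq refl))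
... | tri> _ _ j<i =
  (λ eq → symmetric-flip (run-ext a b) {j} {i} (label-symmetric s a b j<i (sym eq))) ,
  (λ neq → label-asymmetric s a b twins default j<i (neq ∘ sym) ∘ symmetric-flip (run-ext a b) {i} {j})

layerGroups : List (List Bool) → ℕ
layerGroups X = countUniform X + 2 * countMixed X

layerGroups-cons : ∀ l X → layerGroups (l ∷ X) ≡ suc (bit (mixed l)) + layerGroups X
layerGroups-cons l X with mixed l
... | true  = regroup (countUniform X) (countMixed X)
  where
  regroup : ∀ u x → u + 2 * suc x ≡ 2 + (u + 2 * x)
  regroup = solve-∀
... | false = refl

hasVal-cons : ∀ v a acc → hasVal v acc ≡ true → hasVal v (a ∷ acc) ≡ true
hasVal-cons true  true  acc has = refl
hasVal-cons false false acc has = refl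
hasVal-cons true  false acc has = has
hasVal-cons false true  acc has = has

hasVal-single : ∀ a → hasVal a (a ∷ []) ≡ true
hasVal-single true  = refl
hasVal-single false = refl

mixed-single : ∀ a → mixed (a ∷ []) ≡ false
mixed-single true  = refl
mixed-single false = refl

mixed-by-other : ∀ v l → hasVal v l ≡ true → mixed l ≡ hasVal (not v) l
mixed-by-other true  l has rewrite has = refl
mixed-by-other false l has with hasVal true l
... | true rewrite has = refl
... | false = refl

mixed-cons : ∀ a₀ a acc → hasVal a₀ acc ≡ true → mixed (a ∷ acc) ≡ mixed acc ∨ (a xor a₀)
mixed-cons a₀ a acc has
  rewrite mixed-by-other a₀ (a ∷ acc) (hasVal-cons a₀ a acc has) | mixed-by-other a₀ acc has
  = other-cons a₀ a
  where
  other-cons : ∀ a₀ a → hasVal (not a₀) (a ∷ acc) ≡ hasVal (not a₀) acc ∨ (a xor a₀)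
  other-cons true  true  = sym (∨-identityʳ _)
  other-cons false false = sym (∨-identityʳ _)
  other-cons true  false = sym (∨-zeroʳ _)
  other-cons false true  = sym (∨-zeroʳ _)

-- The layer decomposition and the scan count the same labels: continuing from a
-- partially read layer acc (whose first canalyzing value is a₀) after g₀ labels.
layers-count : (β a₀ : Bool) (acc : List Bool) (a b : Fin n → Bool) (g₀ : ℕ) →
  hasVal a₀ acc ≡ true →
  layerGroups (layersAux β acc (tabulate (λ i → a i , b i))) + g₀ ≡ total (scan β a₀ (mixed acc) g₀) a b
layers-count {zero} β a₀ acc a b g₀ _ =
  trans (cong (_+ g₀) (layerGroups-cons acc [])) (close (bit (mixed acc)) g₀)
  where
  close : ∀ x g₀ → suc x + 0 + g₀ ≡ g₀ + suc x
  close = solve-∀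
layers-count {suc n} β a₀ acc a b g₀ has with does (β Bool.≟ head b)
... | true =
  trans (layers-count β a₀ (head a ∷ acc) (tail a) (tail b) g₀ (hasVal-cons a₀ (head a) acc has))
        (cong (λ mx → total (scan β a₀ mx g₀) (tail a) (tail b)) (mixed-cons a₀ (head a) acc has))
... | false = begin
  layerGroups (acc ∷ rest) + g₀                     ≡⟨ cong (_+ g₀) (layerGroups-cons acc rest) ⟩
  suc (bit (mixed acc)) + layerGroups rest + g₀     ≡⟨ close (bit (mixed acc)) (layerGroups rest) g₀ ⟩
  layerGroups rest + g₁                             ≡⟨ layers-count (head b) (head a) (head a ∷ []) (tail a) (tail b) g₁
                                                                    (hasVal-single (head a)) ⟩
  total (scan (head b) (head a) (mixed (head a ∷ [])) g₁) (tail a) (tail b)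
                                                    ≡⟨ cong (λ mx → total (scan (head b) (head a) mx g₁) (tail a) (tail b))
                                                            (mixed-single (head a)) ⟩
  total (scan (head b) (head a) false g₁) (tail a) (tail b) ∎
  where
  open ≡-Reasoning
  g₁ : ℕ
  g₁ = g₀ + suc (bit (mixed acc))
  rest : List (List Bool)
  rest = layersAux (head b) (head a ∷ []) (tabulate (λ i → tail a i , tail b i))
  close : ∀ x g g₀ → suc x + g + g₀ ≡ g + (g₀ + suc x)
  close = solve-∀

initial : (a b : Fin (suc n) → Bool) → Scan
initial a b = scan (head b) (head a) false 0

initial-step : (a b : Fin (suc n) → Bool) → step (initial a b) (head a) (head b) ≡ initial a b
initial-step a b with step (initial a b) (head a) (head b) | step-case (initial a b) (head a) (head b)
... | _ | continue _     = cong (λ x → scan (head b) (head a) x 0) (xor-same (head a))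
... | _ | new-layer flip = ⊥-elim (not-¬ refl flip)

first-label : (a b : Fin (suc n) → Bool) → label (initial a b) a b fzero ≡ 0
first-label a b rewrite initial-step a b = cong bit (xor-same (head a))

labels-onto : (a b : Fin (suc n) → Bool) (v : ℕ) → v < total (initial a b) a b →
  ∃ λ k → label (initial a b) a b k ≡ v
labels-onto a b zero    _     = fzero , first-label a b
labels-onto a b (suc v) v<tot = label-onto (initial a b) a b (suc v) (s≤s z≤n) v<tot

layers-total : (a b : Fin (suc n) → Bool) →
  layerGroups (layersOf (tabulate (λ i → a i , b i))) ≡ total (initial a b) a b
layers-total a b = begin
  layerGroups (layersOf (tabulate (λ i → a i , b i)))          ≡⟨ sym (+-identityʳ _) ⟩
  layerGroups (layersOf (tabulate (λ i → a i , b i))) + 0      ≡⟨ layers-count (head b) (head a) (head a ∷ []) (tail a) (tail b) 0 (hasVal-single (head a)) ⟩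
  total (scan (head b) (head a) (mixed (head a ∷ [])) 0) (tail a) (tail b)
    ≡⟨ cong (λ mx → total (scan (head b) (head a) mx 0) (tail a) (tail b)) (mixed-single (head a)) ⟩
  total (initial a b) (tail a) (tail b)                         ≡⟨ cong (λ s → total s (tail a) (tail b)) (sym (initial-step a b)) ⟩
  total (initial a b) a b                                       ∎
  where open ≡-Reasoning

theorem3 : (m : ℕ) (f : BoolFun (suc (suc m))) (R : Rep (suc (suc m))) →
    (∀ x → f x ≡ eval R x) →
    DefaultNormalized R →
    ProperlyRSymmetric f (countUniform (layers R) + 2 * countMixed (layers R))
theorem3 m f R f≡R normalised =
  subst (ProperlyRSymmetric f) (sym (layers-total a b))
    (properly-symmetric f (total s₀ a b) ℓ (λ v → label-bound s₀ a b (π ⟨$⟩ˡ v)) onto same-label other-label)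
  where
  π = perm R
  a = can R
  b = cvd R
  g : BoolFun (suc (suc m))
  g = run (not (last b)) a b
  s₀ = initial a b
  ℓ : Fin (suc (suc m)) → ℕ
  ℓ v = label s₀ a b (π ⟨$⟩ˡ v)
  transfer : ∀ v w → Symmetric g (π ⟨$⟩ˡ v) (π ⟨$⟩ˡ w) ⇔ Symmetric f v w
  transfer = symmetric-permute π (run-ext a b) (λ x → trans (f≡R x) (evalLines-run _ (π ⟨$⟩ʳ_) a b x))
  decides : ∀ v w → (ℓ v ≡ ℓ w → Symmetric g (π ⟨$⟩ˡ v) (π ⟨$⟩ˡ w)) ×
                    (ℓ v ≢ ℓ w → ¬ Symmetric g (π ⟨$⟩ˡ v) (π ⟨$⟩ˡ w))
  decides v w = label-decides-symmetry {c = head b} s₀ a b (normalised-lastTwo m (head b) b normalised)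
                  refl (π ⟨$⟩ˡ v) (π ⟨$⟩ˡ w)
  onto : ∀ t → t < total s₀ a b → ∃ λ v → ℓ v ≡ t
  onto t t<T with k , k↦t ← labels-onto a b t t<T = π ⟨$⟩ʳ k , trans (cong (label s₀ a b) (inverseˡ π)) k↦t
  same-label : ∀ v w → ℓ v ≡ ℓ w → Symmetric f v w
  same-label v w = Equivalence.to (transfer v w) ∘ proj₁ (decides v w)
  other-label : ∀ v w → ℓ v ≢ ℓ w → ¬ Symmetric f v w
  other-label v w neq = proj₂ (decides v w) neq ∘ Equivalence.from (transfer v w)
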